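{- Let $(M,\leq_M)$ be a finite ordered monoid generated by a set $G$, and let $eval:G^*\to M$ be the evaluation morphism. Suppose $u,v\in G^*$ are such that (i) $u=w_1w_2$ for some $w_1,w_2\in G^*$, (ii) $v$ is a shuffle of $w_1$ and $w_2$, (iii) $eval(u)$ is an idempotent, and (iv) $eval(uvu)\not\leq_M eval(u)$. Then $N^1(M)=\Omega(n)$.
   Context: An ordered monoid is a monoid with a stable partial order ($x\leq y$ implies $zx\leq zy$ and $xz\leq yz$); an order ideal is a downward closed subset. $eval$ sends a word $g_1\cdots g_k$ over $G$ to the product $g_1\cdots g_k$ in $M$. An element $e$ is idempotent if $ee=e$. A word $v$ is a shuffle of $w_1$ and $w_2$ if there exist $k\geq0$ and factorizations $w_1=w_{1,1}\cdots w_{1,k}$, $w_2=w_{2,1}\cdots w_{2,k}$ (factors possibly empty) with $v=w_{1,1}w_{2,1}w_{1,2}w_{2,2}\cdots w_{1,k}w_{2,k}$. For an order ideal $I$, the evaluation problem $(M,I)$ of length $n$: Alice receives $m_1,m_3,\dots,m_{2n-1}\in M$, Bob receives $m_2,\dots,m_{2n}\in M$, output $1$ iff $m_1\cdots m_{2n}\in I$. $N^1(M)$ is the maximum over order ideals $I$ of the non-deterministic communication complexity of $(M,I)$, as a function of $n$ (minimum over protocols with a common proof string $s$, accepting $1$-inputs for some $s$ and $0$-inputs for no $s$, of the maximum over $1$-inputs of the minimum over accepting $s$ of $|s|$ plus bits communicated). -}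

module Defs where

open import Level using (Level; _⊔_; suc)
open import Data.Bool using (Bool; true; false; if_then_else_)
open import Data.Nat using (ℕ; zero) renaming (suc to sucℕ; _+_ to _+ℕ_; _≤_ to _≤ℕ_; _*_ to _*ℕ_)
open import Data.List using (List; []; _∷_; _++_; concat; map; foldr; length)
open import Data.Vec using (Vec; []; _∷_)
open import Data.Fin using (Fin)
open import Data.Product using (Σ; _×_; _,_; proj₁; proj₂; ∃)
open import Relation.Binary.Core using (Rel)
open import Relation.Binary.Structures using (IsPartialOrder)
open import Relation.Binary.PropositionalEquality using (_≡_)
open import Algebra.Bundles using (Monoid)
open import Function.Bundles using (_⇔_)

record OrderedMonoid (c ℓ₁ ℓ₂ : Level) : Set (suc (c ⊔ ℓ₁ ⊔ ℓ₂)) where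
  field
    monoid : Monoid c ℓ₁
  open Monoid monoid public
  field
    _≤_            : Rel Carrier ℓ₂
    isPartialOrder : IsPartialOrder _≈_ _≤_
    stableˡ        : ∀ {x y} z → x ≤ y → (z ∙ x) ≤ (z ∙ y)
    stableʳ        : ∀ {x y} z → x ≤ y → (x ∙ z) ≤ (y ∙ z)

module _ {c ℓ₁ ℓ₂ : Level} (M : OrderedMonoid c ℓ₁ ℓ₂) where
  open OrderedMonoid M

  IsFinite : Set (c ⊔ ℓ₁)
  IsFinite = Σ ℕ λ k → Σ (Fin k → Carrier) λ f → ∀ x → ∃ λ i → f i ≈ x

  eval : ∀ {g} {G : Set g} → (G → Carrier) → List G → Carrier
  eval ι = foldr (λ a m → ι a ∙ m) ε

  Generates : ∀ {g} {G : Set g} → (G → Carrier) → Set (c ⊔ ℓ₁ ⊔ g)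
  Generates {G = G} ι = ∀ x → Σ (List G) λ w → eval ι w ≈ x

  IsIdempotent : Carrier → Set ℓ₁
  IsIdempotent e = (e ∙ e) ≈ e

  IsOrderIdeal : ∀ {p} → (Carrier → Set p) → Set (c ⊔ ℓ₂ ⊔ p)
  IsOrderIdeal I = ∀ {x y} → x ≤ y → I y → I x

  -- m₁ m₂ ⋯ m₂ₙ where Alice holds m₁, m₃, … and Bob holds m₂, m₄, …
  interleavedProduct : ∀ {n} → Vec Carrier n → Vec Carrier n → Carrier
  interleavedProduct []       []       = ε
  interleavedProduct (a ∷ as) (b ∷ bs) = a ∙ (b ∙ interleavedProduct as bs)

-- Shuffle, exactly as in the paper: v is a shuffle of w₁ and w₂ iff there
-- are k ≥ 0 and factorisations w₁ = w₁,₁⋯w₁,ₖ, w₂ = w₂,₁⋯w₂,ₖ with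
-- v = w₁,₁ w₂,₁ ⋯ w₁,ₖ w₂,ₖ.  The list of pairs ps encodes the k pairs
-- (w₁,ᵢ , w₂,ᵢ).

IsShuffle : ∀ {g} {G : Set g} → List G → List G → List G → Set g
IsShuffle {G = G} v w₁ w₂ =
  Σ (List (List G × List G)) λ ps →
    (concat (map proj₁ ps) ≡ w₁) ×
    (concat (map proj₂ ps) ≡ w₂) ×
    (v ≡ concat (map (λ p → proj₁ p ++ proj₂ p) ps))

data Protocol {a b : Level} (X : Set a) (Y : Set b) : Set (a ⊔ b) where
  leaf  : Bool → Protocol X Y
  alice : (X → Bool) → Protocol X Y → Protocol X Y → Protocol X Y
  bob   : (Y → Bool) → Protocol X Y → Protocol X Y → Protocol X Y

module _ {a b : Level} {X : Set a} {Y : Set b} where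

  output : Protocol X Y → X → Y → Bool
  output (leaf o)      x y = o
  output (alice f l r) x y = if f x then output r x y else output l x y
  output (bob f l r)   x y = if f y then output r x y else output l x y

  bits : Protocol X Y → X → Y → ℕ
  bits (leaf o)      x y = zero
  bits (alice f l r) x y = sucℕ (if f x then bits r x y else bits l x y)
  bits (bob f l r)   x y = sucℕ (if f y then bits r x y else bits l x y)

  -- A non-deterministic protocol: for each common proof string s, a
  -- deterministic protocol.  It accepts (x , y) with proof s iff the
  -- protocol for s outputs true.
  NDProtocol : Set (a ⊔ b)
  NDProtocol = List Bool → Protocol X Y

  Accepts : NDProtocol → List Bool → X → Y → Set
  Accepts P s x y = output (P s) x y ≡ true

  Computes : ∀ {p} → NDProtocol → (X → Y → Set p) → Set (a ⊔ b ⊔ p)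
  Computes P F = ∀ x y → F x y ⇔ (∃ λ s → Accepts P s x y)

  CostAtMost : ∀ {p} → NDProtocol → (X → Y → Set p) → ℕ → Set (a ⊔ b ⊔ p)
  CostAtMost P F k =
    ∀ x y → F x y → ∃ λ s → Accepts P s x y × (length s +ℕ bits (P s) x y) ≤ℕ k

module _ {c ℓ₁ ℓ₂ : Level} (M : OrderedMonoid c ℓ₁ ℓ₂) where
  open OrderedMonoid M

  EvalProblem : ∀ {p} → (Carrier → Set p) → (n : ℕ) →
                Vec Carrier n → Vec Carrier n → Set p
  EvalProblem I n x y = I (interleavedProduct M x y)

  -- N¹(M) = Ω(n): there are constants C ≥ 1 and n₀ such that for all
  -- n ≥ n₀ some order ideal I has N(M, I)(n) ≥ n / C, i.e. n ≤ C · N.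
  -- Stated as: every protocol of cost ≤ k for (M, I) has n ≤ C · k.
  N¹-Ω-linear : Set (suc (c ⊔ ℓ₁ ⊔ ℓ₂))
  N¹-Ω-linear =
    Σ ℕ λ C → Σ ℕ λ n₀ → ∀ n → n₀ ≤ℕ n →
      Σ (Carrier → Set (c ⊔ ℓ₁ ⊔ ℓ₂)) λ I → IsOrderIdeal M I ×
        ((P : NDProtocol {X = Vec Carrier n} {Y = Vec Carrier n}) →
         Computes P (EvalProblem I n) →
         ∀ k → CostAtMost P (EvalProblem I n) k → n ≤ℕ C *ℕ k)

-- Let e = eval u and split v into the pieces of the shuffle. Bit vectors a, b ∈ {0,1}^m are encoded
-- as inputs of the evaluation problem whose interleaved product is e · β(a₁,b₁) ⋯ β(aₘ,bₘ), where
-- β(x,y) = v u if x = y = 1 and u u otherwise: Alice contributes the w₁-pieces of v when her bit is 1,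
-- Bob the w₂-pieces when his is, and whoever holds a 0 fills in the missing half of u. As e is
-- idempotent, disjoint pairs evaluate to e, inside the ideal ↓e, and uniquely intersecting pairs to
-- e·v·e, outside it. So a nondeterministic protocol for (M, ↓e) separates disjoint from uniquely
-- intersecting pairs; its accepting leaves give at most 2^(2k+1) rectangles for cost k covering the 3^m
-- disjoint pairs, and a rectangle avoiding uniquely intersecting pairs holds at most 2^m of them. Hence
-- k ≥ m/4 − 1, and each bit uses a fixed number of rounds.

module Submission where

open import Defs
open import Level using (Level; Lift; lift; lower; _⊔_)
open import Function using (_∘_)
open import Function.Bundles using (Equivalence)
open import Data.Bool using (Bool; true; false; _∧_; _∨_; not; if_then_else_)
open import Data.Bool.Properties using (∧-zeroʳ)
open import Data.Empty using (⊥; ⊥-elim)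
open import Relation.Binary.Structures using (IsPartialOrder)
open import Data.Product using (∃; _×_; _,_; proj₁; proj₂)
open import Data.Nat using (ℕ; zero; suc; _+_; _*_; _^_; _∸_; _≤_; _<_; z≤n; s≤s; s≤s⁻¹; NonZero)
open import Data.Nat.Properties
open import Data.Nat.DivMod using (_/_; _%_; m≡m%n+[m/n]*n; m%n<n)
open import Data.Nat.Solver using (module +-*-Solver)
open import Data.List using (List; []; _∷_; _++_; [_]; concat; concatMap; map; length)
open import Data.List.Properties using (length-++; length-map; ++-assoc; ++-identityʳ; concatMap-cong)
open import Data.List.Relation.Unary.All as All using (All; []; _∷_)
import Data.List.Relation.Unary.All.Properties as All
open import Data.List.Relation.Unary.Any as Any using (Any; here; there)
import Data.List.Relation.Unary.Any.Properties as Any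
open import Data.Vec as Vec using (Vec; []; _∷_)
open import Relation.Binary.PropositionalEquality using (_≡_; refl; sym; trans; cong; cong₂; subst; module ≡-Reasoning)
open import Relation.Nullary using (¬_; contradiction; yes; no)

open +-*-Solver using (solve; _:=_; _:+_; _:*_; con)

-- Unique disjointness and its rectangle bound

data Disjoint : ∀ {m} → Vec Bool m → Vec Bool m → Set where
  []  : Disjoint [] []
  _∷_ : ∀ {m x y} {a b : Vec Bool m} → x ∧ y ≡ false → Disjoint a b → Disjoint (x ∷ a) (y ∷ b)

data UniquelyIntersecting : ∀ {m} → Vec Bool m → Vec Bool m → Set where
  here  : ∀ {m} {a b : Vec Bool m} → Disjoint a b → UniquelyIntersecting (true ∷ a) (true ∷ b)
  there : ∀ {m x y} {a b : Vec Bool m} →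
          x ∧ y ≡ false → UniquelyIntersecting a b → UniquelyIntersecting (x ∷ a) (y ∷ b)

fixHeads : ∀ {m} → (Vec Bool (suc m) → Vec Bool (suc m) → ℕ) → Bool → Bool → Vec Bool m → Vec Bool m → ℕ
fixHeads F x y a b = F (x ∷ a) (y ∷ b)

-- The sum of F a b over the 3 ^ m disjoint pairs (a , b).
sumDisjoint : ∀ m → (Vec Bool m → Vec Bool m → ℕ) → ℕ
sumDisjoint zero    F = F [] []
sumDisjoint (suc m) F = sumDisjoint m (fixHeads F false false)
                      + sumDisjoint m (fixHeads F true false)
                      + sumDisjoint m (fixHeads F false true)

sumDisjoint-mono : ∀ m {F G : Vec Bool m → Vec Bool m → ℕ} →
                   (∀ a b → Disjoint a b → F a b ≤ G a b) → sumDisjoint m F ≤ sumDisjoint m G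
sumDisjoint-mono zero    F≤G = F≤G [] [] []
sumDisjoint-mono (suc m) F≤G =
  +-mono-≤ (+-mono-≤ (sumDisjoint-mono m λ a b d → F≤G _ _ (refl ∷ d))
                     (sumDisjoint-mono m λ a b d → F≤G _ _ (refl ∷ d)))
           (sumDisjoint-mono m λ a b d → F≤G _ _ (refl ∷ d))

+-interchange₃ : ∀ a b c d e f → (a + d) + (b + e) + (c + f) ≡ (a + b + c) + (d + e + f)
+-interchange₃ = solve 6 (λ a b c d e f → (a :+ d) :+ (b :+ e) :+ (c :+ f) := (a :+ b :+ c) :+ (d :+ e :+ f)) refl

sumDisjoint-+ : ∀ m (F G : Vec Bool m → Vec Bool m → ℕ) →
                sumDisjoint m (λ a b → F a b + G a b) ≡ sumDisjoint m F + sumDisjoint m G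
sumDisjoint-+ zero    F G = refl
sumDisjoint-+ (suc m) F G =
  trans (cong₂ _+_ (cong₂ _+_ (sum-+ false false) (sum-+ true false)) (sum-+ false true))
        (+-interchange₃ (S F false false) (S F true false) (S F false true)
                        (S G false false) (S G true false) (S G false true))
  where
  S : (Vec Bool (suc m) → Vec Bool (suc m) → ℕ) → Bool → Bool → ℕ
  S H x y = sumDisjoint m (fixHeads H x y)
  sum-+ : ∀ x y → sumDisjoint m (fixHeads (λ a b → F a b + G a b) x y) ≡ S F x y + S G x y
  sum-+ x y = sumDisjoint-+ m (fixHeads F x y) (fixHeads G x y)

sumDisjoint-0 : ∀ m → sumDisjoint m (λ _ _ → 0) ≡ 0
sumDisjoint-0 zero    = refl
sumDisjoint-0 (suc m) rewrite sumDisjoint-0 m = refl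

sumDisjoint-1 : ∀ m → sumDisjoint m (λ _ _ → 1) ≡ 3 ^ m
sumDisjoint-1 zero    = refl
sumDisjoint-1 (suc m) rewrite sumDisjoint-1 m = solve 1 (λ x → x :+ x :+ x := con 3 :* x) refl (3 ^ m)

Rectangle : ∀ {a b} → Set a → Set b → Set (a ⊔ b)
Rectangle X Y = (X → Bool) × (Y → Bool)

contains : ∀ {a b} {X : Set a} {Y : Set b} → Rectangle X Y → X → Y → Bool
contains (A , B) x y = A x ∧ B y

Covers : ∀ {a b} {X : Set a} {Y : Set b} → List (Rectangle X Y) → X → Y → Set (a ⊔ b)
Covers Rs x y = Any (λ R → contains R x y ≡ true) Rs

contains-intro : ∀ {a b} {X : Set a} {Y : Set b} {A : X → Bool} {B : Y → Bool} {x y} →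
                 A x ≡ true → B y ≡ true → contains (A , B) x y ≡ true
contains-intro Ax By rewrite Ax | By = refl

indicator : Bool → ℕ
indicator b = if b then 1 else 0

indicator≤1 : ∀ b → indicator b ≤ 1
indicator≤1 true  = ≤-refl
indicator≤1 false = z≤n

NoUniqueIntersection : ∀ {m} → Rectangle (Vec Bool m) (Vec Bool m) → Set
NoUniqueIntersection (A , B) = ∀ a b → A a ≡ true → B b ≡ true → ¬ UniquelyIntersecting a b

module _ {m} {A B : Vec Bool m → Bool} where

  NoUniqueIntersection-∪ˡ : ∀ {A′} → NoUniqueIntersection (A , B) → NoUniqueIntersection (A′ , B) →
                            NoUniqueIntersection ((λ a → A a ∨ A′ a) , B)
  NoUniqueIntersection-∪ˡ h h′ a b ea eb with A a in eq
  ... | true  = h a b eq eb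
  ... | false = h′ a b ea eb

  NoUniqueIntersection-∪ʳ : ∀ {B′} → NoUniqueIntersection (A , B) → NoUniqueIntersection (A , B′) →
                            NoUniqueIntersection (A , (λ b → B b ∨ B′ b))
  NoUniqueIntersection-∪ʳ h h′ a b ea eb with B b in eq
  ... | true  = h a b ea eq
  ... | false = h′ a b ea eb

NoUniqueIntersection-tail : ∀ {m} {A B : Vec Bool (suc m) → Bool} x y → x ∧ y ≡ false →
  NoUniqueIntersection (A , B) → NoUniqueIntersection ((λ a → A (x ∷ a)) , (λ b → B (y ∷ b)))
NoUniqueIntersection-tail x y x∧y h a b ea eb u = h _ _ ea eb (there x∧y u)

-- p, q, r, s stand for A (0 ∷ a), A (1 ∷ a), B (0 ∷ b), B (1 ∷ b).
indicator-split : ∀ p q r s → (q ≡ true → s ≡ true → ⊥) →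
  indicator (p ∧ r) + indicator (q ∧ r) + indicator (p ∧ s) ≤ indicator ((p ∨ q) ∧ r) + indicator (p ∧ (r ∨ s))
indicator-split false _     _     _     _ = ≤-refl
indicator-split true  true  _     true  h = ⊥-elim (h refl refl)
indicator-split true  true  true  false _ = ≤-refl
indicator-split true  true  false false _ = ≤-refl
indicator-split true  false true  true  _ = ≤-refl
indicator-split true  false true  false _ = n≤1+n 1
indicator-split true  false false _     _ = ≤-refl

-- Split off the first coordinate: the disjoint pairs of A × B with heads (0,0), (1,0), (0,1) fit into
-- (A₀ ∪ A₁) × B₀ and A₀ × (B₀ ∪ B₁), because A₁ × B₁ contains no disjoint pair of tails.
rectangle-sumDisjoint≤2^ : ∀ m (R : Rectangle (Vec Bool m) (Vec Bool m)) → NoUniqueIntersection R →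
                           sumDisjoint m (λ a b → indicator (contains R a b)) ≤ 2 ^ m
rectangle-sumDisjoint≤2^ zero    (A , B) _    = indicator≤1 (A [] ∧ B [])
rectangle-sumDisjoint≤2^ (suc m) (A , B) noUI = begin
  count A₀ B₀ + count A₁ B₀ + count A₀ B₁
    ≡⟨ sym (trans (sumDisjoint-+ m _ _) (cong (_+ count A₀ B₁) (sumDisjoint-+ m _ _))) ⟩
  sumDisjoint m (λ a b → ind A₀ B₀ a b + ind A₁ B₀ a b + ind A₀ B₁ a b)
    ≤⟨ sumDisjoint-mono m (λ a b d → indicator-split (A₀ a) (A₁ a) (B₀ b) (B₁ b) (λ ea eb → noUI _ _ ea eb (here d))) ⟩
  sumDisjoint m (λ a b → ind A₀₁ B₀ a b + ind A₀ B₀₁ a b)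
    ≡⟨ sumDisjoint-+ m _ _ ⟩
  count A₀₁ B₀ + count A₀ B₀₁
    ≤⟨ +-mono-≤ (rectangle-sumDisjoint≤2^ m (A₀₁ , B₀) (NoUniqueIntersection-∪ˡ noUI₀₀ noUI₁₀))
                (rectangle-sumDisjoint≤2^ m (A₀ , B₀₁) (NoUniqueIntersection-∪ʳ noUI₀₀ noUI₀₁)) ⟩
  2 ^ m + 2 ^ m
    ≡⟨ cong (2 ^ m +_) (sym (+-identityʳ (2 ^ m))) ⟩
  2 ^ suc m ∎
  where
  open ≤-Reasoning
  A₀ A₁ A₀₁ B₀ B₁ B₀₁ : Vec Bool m → Bool
  A₀ a = A (false ∷ a)
  A₁ a = A (true ∷ a)
  A₀₁ a = A₀ a ∨ A₁ a
  B₀ b = B (false ∷ b)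
  B₁ b = B (true ∷ b)
  B₀₁ b = B₀ b ∨ B₁ b
  ind : (Vec Bool m → Bool) → (Vec Bool m → Bool) → Vec Bool m → Vec Bool m → ℕ
  ind A′ B′ a b = indicator (A′ a ∧ B′ b)
  count : (Vec Bool m → Bool) → (Vec Bool m → Bool) → ℕ
  count A′ B′ = sumDisjoint m (ind A′ B′)
  noUI₀₀ : NoUniqueIntersection (A₀ , B₀)
  noUI₀₀ = NoUniqueIntersection-tail false false refl noUI
  noUI₁₀ : NoUniqueIntersection (A₁ , B₀)
  noUI₁₀ = NoUniqueIntersection-tail true  false refl noUI
  noUI₀₁ : NoUniqueIntersection (A₀ , B₁)
  noUI₀₁ = NoUniqueIntersection-tail false true  refl noUI

module _ {a b} {X : Set a} {Y : Set b} where

  multiplicity : List (Rectangle X Y) → X → Y → ℕ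
  multiplicity []       x y = 0
  multiplicity (R ∷ Rs) x y = indicator (contains R x y) + multiplicity Rs x y

  multiplicity-≥1 : ∀ {Rs x y} → Covers Rs x y → 1 ≤ multiplicity Rs x y
  multiplicity-≥1 (here  x∈R)  rewrite x∈R = s≤s z≤n
  multiplicity-≥1 (there x∈Rs) = ≤-trans (multiplicity-≥1 x∈Rs) (m≤n+m _ _)

sumDisjoint-multiplicity : ∀ m {Rs : List (Rectangle (Vec Bool m) (Vec Bool m))} →
                           All NoUniqueIntersection Rs → sumDisjoint m (multiplicity Rs) ≤ length Rs * 2 ^ m
sumDisjoint-multiplicity m []                    = ≤-reflexive (sumDisjoint-0 m)
sumDisjoint-multiplicity m {R ∷ Rs} (noUI ∷ noUIs) = begin
  sumDisjoint m (multiplicity (R ∷ Rs))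
    ≡⟨ sumDisjoint-+ m (λ a b → indicator (contains R a b)) (multiplicity Rs) ⟩
  sumDisjoint m (λ a b → indicator (contains R a b)) + sumDisjoint m (multiplicity Rs)
    ≤⟨ +-mono-≤ (rectangle-sumDisjoint≤2^ m R noUI) (sumDisjoint-multiplicity m noUIs) ⟩
  2 ^ m + length Rs * 2 ^ m ∎
  where open ≤-Reasoning

cover-bound : ∀ m (Rs : List (Rectangle (Vec Bool m) (Vec Bool m))) →
              (∀ a b → Disjoint a b → Covers Rs a b) →
              All NoUniqueIntersection Rs → 3 ^ m ≤ length Rs * 2 ^ m
cover-bound m Rs covers noUIs = begin
  3 ^ m                          ≡⟨ sym (sumDisjoint-1 m) ⟩
  sumDisjoint m (λ _ _ → 1)      ≤⟨ sumDisjoint-mono m (λ a b d → multiplicity-≥1 (covers a b d)) ⟩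
  sumDisjoint m (multiplicity Rs) ≤⟨ sumDisjoint-multiplicity m noUIs ⟩
  length Rs * 2 ^ m              ∎
  where open ≤-Reasoning

-- Rectangles of protocols

module _ {a b} {X : Set a} {Y : Set b} where

  narrowˡ : (X → Bool) → Rectangle X Y → Rectangle X Y
  narrowˡ f (A , B) = (λ x → f x ∧ A x) , B

  narrowʳ : (Y → Bool) → Rectangle X Y → Rectangle X Y
  narrowʳ f (A , B) = A , (λ y → f y ∧ B y)

  acceptingRectangles : Protocol X Y → ℕ → List (Rectangle X Y)
  acceptingRectangles (leaf true)   _       = [ (λ _ → true) , (λ _ → true) ]
  acceptingRectangles (leaf false)  _       = []
  acceptingRectangles (alice f l r) zero    = []
  acceptingRectangles (alice f l r) (suc d) =
    map (narrowˡ (not ∘ f)) (acceptingRectangles l d) ++ map (narrowˡ f) (acceptingRectangles r d)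
  acceptingRectangles (bob f l r)   zero    = []
  acceptingRectangles (bob f l r)   (suc d) =
    map (narrowʳ (not ∘ f)) (acceptingRectangles l d) ++ map (narrowʳ f) (acceptingRectangles r d)

  length-branches≤2^ : ∀ {g h : Rectangle X Y → Rectangle X Y} Rs Ss d →
                       length Rs ≤ 2 ^ d → length Ss ≤ 2 ^ d → length (map g Rs ++ map h Ss) ≤ 2 ^ suc d
  length-branches≤2^ {g} {h} Rs Ss d Rs≤ Ss≤ = begin
    length (map g Rs ++ map h Ss)  ≡⟨ length-++ (map g Rs) ⟩
    length (map g Rs) + length (map h Ss)
      ≡⟨ cong₂ _+_ (length-map g Rs) (length-map h Ss) ⟩
    length Rs + length Ss          ≤⟨ +-mono-≤ Rs≤ Ss≤ ⟩
    2 ^ d + 2 ^ d                  ≡⟨ cong (2 ^ d +_) (sym (+-identityʳ (2 ^ d))) ⟩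
    2 ^ suc d                      ∎
    where open ≤-Reasoning

  length-acceptingRectangles : ∀ p d → length (acceptingRectangles p d) ≤ 2 ^ d
  length-acceptingRectangles (leaf true)   d       = m^n>0 2 d
  length-acceptingRectangles (leaf false)  d       = z≤n
  length-acceptingRectangles (alice f l r) zero    = z≤n
  length-acceptingRectangles (alice f l r) (suc d) =
    length-branches≤2^ (acceptingRectangles l d) (acceptingRectangles r d) d
      (length-acceptingRectangles l d) (length-acceptingRectangles r d)
  length-acceptingRectangles (bob f l r)   zero    = z≤n
  length-acceptingRectangles (bob f l r)   (suc d) =
    length-branches≤2^ (acceptingRectangles l d) (acceptingRectangles r d) d
      (length-acceptingRectangles l d) (length-acceptingRectangles r d)

  narrowˡ-covers : ∀ f {x y Rs} → f x ≡ true → Covers Rs x y → Covers (map (narrowˡ f) Rs) x y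
  narrowˡ-covers f fx = Any.map⁺ ∘ Any.map λ { {A , B} x∈R → subst (λ b → (b ∧ A _) ∧ B _ ≡ true) (sym fx) x∈R }

  narrowʳ-covers : ∀ f {x y Rs} → f y ≡ true → Covers Rs x y → Covers (map (narrowʳ f) Rs) x y
  narrowʳ-covers f fy = Any.map⁺ ∘ Any.map λ { {A , B} x∈R → subst (λ b → A _ ∧ (b ∧ B _) ≡ true) (sym fy) x∈R }

  acceptingRectangles-complete : ∀ p d x y → output p x y ≡ true → bits p x y ≤ d →
                                 Covers (acceptingRectangles p d) x y
  acceptingRectangles-complete (leaf true)   d       x y _   _        = here refl
  acceptingRectangles-complete (alice f l r) (suc d) x y out (s≤s bd) with f x in fx
  ... | true  = Any.++⁺ʳ _ (narrowˡ-covers f fx (acceptingRectangles-complete r d x y out bd))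
  ... | false = Any.++⁺ˡ (narrowˡ-covers (not ∘ f) (cong not fx) (acceptingRectangles-complete l d x y out bd))
  acceptingRectangles-complete (bob f l r)   (suc d) x y out (s≤s bd) with f y in fy
  ... | true  = Any.++⁺ʳ _ (narrowʳ-covers f fy (acceptingRectangles-complete r d x y out bd))
  ... | false = Any.++⁺ˡ (narrowʳ-covers (not ∘ f) (cong not fy) (acceptingRectangles-complete l d x y out bd))

  Inside : ∀ {p} → (X → Y → Set p) → Rectangle X Y → Set (a ⊔ b ⊔ p)
  Inside F R = ∀ x y → contains R x y ≡ true → F x y

  AcceptsOn : Protocol X Y → Rectangle X Y → Set (a ⊔ b)
  AcceptsOn p = Inside (λ x y → output p x y ≡ true)

  AcceptsOn-map : ∀ p q {Rs} (g : Rectangle X Y → Rectangle X Y) → (∀ {R} → AcceptsOn p R → AcceptsOn q (g R)) →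
                  All (AcceptsOn p) Rs → All (AcceptsOn q) (map g Rs)
  AcceptsOn-map p q g h = All.map⁺ ∘ All.map h

  acceptingRectangles-sound : ∀ p d → All (AcceptsOn p) (acceptingRectangles p d)
  acceptingRectangles-sound (leaf true)   d       = (λ _ _ _ → refl) ∷ []
  acceptingRectangles-sound (leaf false)  d       = []
  acceptingRectangles-sound (alice f l r) zero    = []
  acceptingRectangles-sound (alice f l r) (suc d) =
    All.++⁺ (AcceptsOn-map l (alice f l r) (narrowˡ (not ∘ f)) aliceˡ (acceptingRectangles-sound l d))
            (AcceptsOn-map r (alice f l r) (narrowˡ f) aliceʳ (acceptingRectangles-sound r d))
    where
    aliceˡ : ∀ {R} → AcceptsOn l R → AcceptsOn (alice f l r) (narrowˡ (not ∘ f) R)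
    aliceˡ h x y x∈R with f x
    ... | false = h x y x∈R
    ... | true  = contradiction x∈R λ ()
    aliceʳ : ∀ {R} → AcceptsOn r R → AcceptsOn (alice f l r) (narrowˡ f R)
    aliceʳ h x y x∈R with f x
    ... | true  = h x y x∈R
    ... | false = contradiction x∈R λ ()
  acceptingRectangles-sound (bob f l r)   zero    = []
  acceptingRectangles-sound (bob f l r)   (suc d) =
    All.++⁺ (AcceptsOn-map l (bob f l r) (narrowʳ (not ∘ f)) (λ {R} → bobˡ {R}) (acceptingRectangles-sound l d))
            (AcceptsOn-map r (bob f l r) (narrowʳ f) (λ {R} → bobʳ {R}) (acceptingRectangles-sound r d))
    where
    bobˡ : ∀ {R} → AcceptsOn l R → AcceptsOn (bob f l r) (narrowʳ (not ∘ f) R)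
    bobˡ {R} h x y x∈R with f y
    ... | false = h x y x∈R
    ... | true  = contradiction (trans (sym (∧-zeroʳ (proj₁ R x))) x∈R) λ ()
    bobʳ : ∀ {R} → AcceptsOn r R → AcceptsOn (bob f l r) (narrowʳ f R)
    bobʳ {R} h x y x∈R with f y
    ... | true  = h x y x∈R
    ... | false = contradiction (trans (sym (∧-zeroʳ (proj₁ R x))) x∈R) λ ()

stringsUpTo : ℕ → List (List Bool)
stringsUpTo zero    = [ [] ]
stringsUpTo (suc k) = [] ∷ map (true ∷_) (stringsUpTo k) ++ map (false ∷_) (stringsUpTo k)

length-stringsUpTo : ∀ k → length (stringsUpTo k) < 2 ^ suc k
length-stringsUpTo zero    = ≤-refl
length-stringsUpTo (suc k) = begin-strict
  length (stringsUpTo (suc k))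
    ≡⟨ cong suc (trans (length-++ (map (true ∷_) S)) (cong₂ _+_ (length-map (true ∷_) S) (length-map (false ∷_) S))) ⟩
  suc (length S + length S) ≤⟨ +-monoˡ-≤ (length S) (length-stringsUpTo k) ⟩
  2 ^ suc k + length S      <⟨ +-monoʳ-< (2 ^ suc k) (length-stringsUpTo k) ⟩
  2 ^ suc k + 2 ^ suc k     ≡⟨ cong (2 ^ suc k +_) (sym (+-identityʳ (2 ^ suc k))) ⟩
  2 ^ suc (suc k)           ∎
  where
  open ≤-Reasoning
  S = stringsUpTo k

stringsUpTo-complete : ∀ {p} {P : List Bool → Set p} k s → length s ≤ k → P s → Any P (stringsUpTo k)
stringsUpTo-complete zero    []          _        Ps = here Ps
stringsUpTo-complete (suc k) []          _        Ps = here Ps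
stringsUpTo-complete (suc k) (true ∷ s)  (s≤s ls) Ps = there (Any.++⁺ˡ (Any.map⁺ (stringsUpTo-complete k s ls Ps)))
stringsUpTo-complete (suc k) (false ∷ s) (s≤s ls) Ps =
  there (Any.++⁺ʳ _ (Any.map⁺ (stringsUpTo-complete k s ls Ps)))

length-concatMap≤ : ∀ {a b} {A : Set a} {B : Set b} (f : A → List B) {n} xs →
                    (∀ x → length (f x) ≤ n) → length (concatMap f xs) ≤ length xs * n
length-concatMap≤ f []       _  = z≤n
length-concatMap≤ f (x ∷ xs) fx≤ =
  ≤-trans (≤-reflexive (length-++ (f x))) (+-mono-≤ (fx≤ x) (length-concatMap≤ f xs fx≤))

module _ {a b} {X : Set a} {Y : Set b} where

  ndRectangles : NDProtocol {X = X} {Y = Y} → ℕ → List (Rectangle X Y)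
  ndRectangles P k = concatMap (λ s → acceptingRectangles (P s) k) (stringsUpTo k)

  length-ndRectangles : ∀ P k → length (ndRectangles P k) ≤ 2 ^ suc k * 2 ^ k
  length-ndRectangles P k =
    ≤-trans (length-concatMap≤ (λ s → acceptingRectangles (P s) k) (stringsUpTo k) (λ s → length-acceptingRectangles (P s) k))
            (*-monoˡ-≤ (2 ^ k) (<⇒≤ (length-stringsUpTo k)))

  ndRectangles-complete : ∀ P k {x y} s → Accepts P s x y → length s + bits (P s) x y ≤ k →
                          Covers (ndRectangles P k) x y
  ndRectangles-complete P k {x} {y} s acc cost = Any.concatMap⁺ (λ s → acceptingRectangles (P s) k)
    (stringsUpTo-complete k s (m+n≤o⇒m≤o (length s) cost)
      (acceptingRectangles-complete (P s) k x y acc (m+n≤o⇒n≤o (length s) cost)))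

  ndRectangles-sound : ∀ P k → All (Inside (λ x y → ∃ λ s → Accepts P s x y)) (ndRectangles P k)
  ndRectangles-sound P k = All.concat⁺ (All.map⁺ (All.universal
    (λ s → All.map (λ h x y x∈R → s , h x y x∈R) (acceptingRectangles-sound (P s) k)) (stringsUpTo k)))

2^j*2^m<3^m : ∀ j t → 2 ^ j * 2 ^ (2 * suc j + t) < 3 ^ (2 * suc j + t)
2^j*2^m<3^m j t = begin-strict
  2 ^ j * 2 ^ (2 * J + t) ≡⟨ sym (^-distribˡ-+-* 2 j (2 * J + t)) ⟩
  2 ^ (j + (2 * J + t))   <⟨ ^-monoʳ-< 2 (n<1+n 1) (≤-reflexive exponent) ⟩
  2 ^ (3 * J + t)         ≡⟨ ^-distribˡ-+-* 2 (3 * J) t ⟩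
  2 ^ (3 * J) * 2 ^ t     ≡⟨ cong (_* 2 ^ t) (sym (^-*-assoc 2 3 J)) ⟩
  8 ^ J * 2 ^ t           ≤⟨ *-mono-≤ (^-monoˡ-≤ J (n≤1+n 8)) (^-monoˡ-≤ t (n≤1+n 2)) ⟩
  9 ^ J * 3 ^ t           ≡⟨ cong (_* 3 ^ t) (^-*-assoc 3 2 J) ⟩
  3 ^ (2 * J) * 3 ^ t     ≡⟨ sym (^-distribˡ-+-* 3 (2 * J) t) ⟩
  3 ^ (2 * J + t)         ∎
  where
  open ≤-Reasoning
  J = suc j
  exponent : suc (j + (2 * J + t)) ≡ 3 * J + t
  exponent = solve 2 (λ j t → con 1 :+ (j :+ (con 2 :* (con 1 :+ j) :+ t)) := con 3 :* (con 1 :+ j) :+ t) refl j t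

3^m≤2^j*2^m⇒m<2[1+j] : ∀ m j → 3 ^ m ≤ 2 ^ j * 2 ^ m → m < 2 * suc j
3^m≤2^j*2^m⇒m<2[1+j] m j 3^m≤ with m <? 2 * suc j
... | yes m< = m<
... | no  m≮ = contradiction 3^m≤ (<⇒≱ (subst (λ n → 2 ^ j * 2 ^ n < 3 ^ n) (m+[n∸m]≡n (≮⇒≥ m≮))
                                              (2^j*2^m<3^m j (m ∸ 2 * suc j))))

disjointness-lowerBound : ∀ m (P : NDProtocol {X = Vec Bool m} {Y = Vec Bool m}) k →
  (∀ a b → Disjoint a b → ∃ λ s → Accepts P s a b × length s + bits (P s) a b ≤ k) →
  (∀ s a b → Accepts P s a b → ¬ UniquelyIntersecting a b) →
  m < 4 * suc k
disjointness-lowerBound m P k accepts rejects =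
  subst (m <_) (solve 1 (λ k → con 2 :* (con 1 :+ (con 1 :+ k :+ k)) := con 4 :* (con 1 :+ k)) refl k)
        (3^m≤2^j*2^m⇒m<2[1+j] m (suc k + k) (begin
          3 ^ m                     ≤⟨ cover-bound m Rs covers noUIs ⟩
          length Rs * 2 ^ m         ≤⟨ *-monoˡ-≤ (2 ^ m) (length-ndRectangles P k) ⟩
          2 ^ suc k * 2 ^ k * 2 ^ m ≡⟨ cong (_* 2 ^ m) (sym (^-distribˡ-+-* 2 (suc k) k)) ⟩
          2 ^ (suc k + k) * 2 ^ m   ∎))
  where
  open ≤-Reasoning
  Rs = ndRectangles P k
  covers : ∀ a b → Disjoint a b → Covers Rs a b
  covers a b d = let s , acc , cost = accepts a b d in ndRectangles-complete P k s acc cost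
  noUIs : All NoUniqueIntersection Rs
  noUIs = All.map noUI (ndRectangles-sound P k)
    where
    noUI : ∀ {R} → Inside (λ x y → ∃ λ s → Accepts P s x y) R → NoUniqueIntersection R
    noUI {A , B} acceptedIn a b ea eb with acceptedIn a b (contains-intro {A = A} {B = B} ea eb)
    ... | s , acc = rejects s a b acc

module _ {a a′ b b′} {X : Set a} {X′ : Set a′} {Y : Set b} {Y′ : Set b′} (α : X′ → X) (β : Y′ → Y) where

  precompose : Protocol X Y → Protocol X′ Y′
  precompose (leaf o)      = leaf o
  precompose (alice f l r) = alice (f ∘ α) (precompose l) (precompose r)
  precompose (bob f l r)   = bob (f ∘ β) (precompose l) (precompose r)

  output-precompose : ∀ p x y → output (precompose p) x y ≡ output p (α x) (β y)
  output-precompose (leaf o)      x y = refl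
  output-precompose (alice f l r) x y with f (α x)
  ... | true  = output-precompose r x y
  ... | false = output-precompose l x y
  output-precompose (bob f l r)   x y with f (β y)
  ... | true  = output-precompose r x y
  ... | false = output-precompose l x y

  bits-precompose : ∀ p x y → bits (precompose p) x y ≡ bits p (α x) (β y)
  bits-precompose (leaf o)      x y = refl
  bits-precompose (alice f l r) x y with f (α x)
  ... | true  = cong suc (bits-precompose r x y)
  ... | false = cong suc (bits-precompose l x y)
  bits-precompose (bob f l r)   x y with f (β y)
  ... | true  = cong suc (bits-precompose r x y)
  ... | false = cong suc (bits-precompose l x y)

-- Encoding unique disjointness into the evaluation problem

module _ {a} {A : Set a} where

  keep : Bool → List A → List A
  keep b w = if b then w else []

  interleave : ∀ {n} → Vec (List A) n → Vec (List A) n → List A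
  interleave []       []       = []
  interleave (x ∷ xs) (y ∷ ys) = x ++ y ++ interleave xs ys

  interleave-++ : ∀ {n k} (xs ys : Vec (List A) n) (xs′ ys′ : Vec (List A) k) →
                  interleave (xs Vec.++ xs′) (ys Vec.++ ys′) ≡ interleave xs ys ++ interleave xs′ ys′
  interleave-++ []       []       xs′ ys′ = refl
  interleave-++ (x ∷ xs) (y ∷ ys) xs′ ys′ = begin
    x ++ y ++ interleave (xs Vec.++ xs′) (ys Vec.++ ys′)     ≡⟨ cong (λ w → x ++ y ++ w) (interleave-++ xs ys xs′ ys′) ⟩
    x ++ y ++ (interleave xs ys ++ interleave xs′ ys′)       ≡⟨ cong (x ++_) (sym (++-assoc y _ _)) ⟩
    x ++ (y ++ interleave xs ys) ++ interleave xs′ ys′       ≡⟨ sym (++-assoc x _ _) ⟩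
    (x ++ y ++ interleave xs ys) ++ interleave xs′ ys′       ∎
    where open ≡-Reasoning

  interleave-replicate : ∀ n → interleave (Vec.replicate n []) (Vec.replicate n []) ≡ []
  interleave-replicate zero    = refl
  interleave-replicate (suc n) = interleave-replicate n

  interleave-pairs : ∀ x y (ps : List (List A × List A)) →
    interleave (Vec.map (keep x ∘ proj₁) (Vec.fromList ps)) (Vec.map (keep y ∘ proj₂) (Vec.fromList ps))
      ≡ concatMap (λ p → keep x (proj₁ p) ++ keep y (proj₂ p)) ps
  interleave-pairs x y []       = refl
  interleave-pairs x y (p ∷ ps) =
    trans (cong (keep x (proj₁ p) ++_) (cong (keep y (proj₂ p) ++_) (interleave-pairs x y ps)))
          (sym (++-assoc (keep x (proj₁ p)) (keep y (proj₂ p)) _))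

  concatMap-[] : ∀ {b} {B : Set b} (xs : List B) → concatMap (λ _ → []) xs ≡ ([] {A = A})
  concatMap-[] []       = refl
  concatMap-[] (_ ∷ xs) = concatMap-[] xs

module _ {c ℓ₁ ℓ₂ g} (M : OrderedMonoid c ℓ₁ ℓ₂) {G : Set g} (ι : G → OrderedMonoid.Carrier M) where
  open OrderedMonoid M using (_≈_; _∙_; identityˡ; assoc; ∙-congˡ)
    renaming (refl to ≈-refl; sym to ≈-sym; trans to ≈-trans)

  eval-++ : ∀ xs ys → eval M ι (xs ++ ys) ≈ eval M ι xs ∙ eval M ι ys
  eval-++ []       ys = ≈-sym (identityˡ (eval M ι ys))
  eval-++ (x ∷ xs) ys = ≈-trans (∙-congˡ (eval-++ xs ys)) (≈-sym (assoc (ι x) (eval M ι xs) (eval M ι ys)))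

  interleavedProduct-eval : ∀ {n} (xs ys : Vec (List G) n) →
    interleavedProduct M (Vec.map (eval M ι) xs) (Vec.map (eval M ι) ys) ≈ eval M ι (interleave xs ys)
  interleavedProduct-eval []       []       = ≈-refl
  interleavedProduct-eval (x ∷ xs) (y ∷ ys) =
    ≈-trans (∙-congˡ (≈-trans (∙-congˡ (interleavedProduct-eval xs ys)) (≈-sym (eval-++ y (interleave xs ys)))))
            (≈-sym (eval-++ x (y ++ interleave xs ys)))

  eval-++-cong : ∀ xs {ys ys′} → eval M ι ys ≈ eval M ι ys′ → eval M ι (xs ++ ys) ≈ eval M ι (xs ++ ys′)
  eval-++-cong xs {ys} {ys′} ys≈ys′ = ≈-trans (eval-++ xs ys) (≈-trans (∙-congˡ ys≈ys′) (≈-sym (eval-++ xs ys′)))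

module _ {c ℓ₁ ℓ₂} (M : OrderedMonoid c ℓ₁ ℓ₂) where
  open OrderedMonoid M using (Carrier; isPartialOrder) renaming (_≤_ to _≤ᴹ_)

  Below : Carrier → Carrier → Set (c ⊔ ℓ₁ ⊔ ℓ₂)
  Below e x = Lift (c ⊔ ℓ₁) (x ≤ᴹ e)

  Below-isOrderIdeal : ∀ e → IsOrderIdeal M (Below e)
  Below-isOrderIdeal e x≤y (lift y≤e) = lift (IsPartialOrder.trans isPartialOrder x≤y y≤e)

module ShuffleEncoding {c ℓ₁ ℓ₂ g} (M : OrderedMonoid c ℓ₁ ℓ₂) {G : Set g} (ι : G → OrderedMonoid.Carrier M)
                       (ps : List (List G × List G)) where
  open OrderedMonoid M using (Carrier; _≈_; _∙_; assoc; ∙-congˡ; ∙-congʳ; isPartialOrder)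
    renaming (_≤_ to _≤ᴹ_; refl to ≈-refl; sym to ≈-sym; trans to ≈-trans; reflexive to ≈-reflexive)
  open IsPartialOrder isPartialOrder using (≤-respˡ-≈) renaming (reflexive to ≤ᴹ-reflexive)

  E : List G → Carrier
  E = eval M ι

  w₁ w₂ u v : List G
  w₁ = concat (map proj₁ ps)
  w₂ = concat (map proj₂ ps)
  u  = w₁ ++ w₂
  v  = concatMap (λ p → proj₁ p ++ proj₂ p) ps

  blockLength : ℕ
  blockLength = suc (length ps + 1)

  aliceBlock : Bool → Vec (List G) blockLength
  aliceBlock x = keep (not x) w₁ ∷ (Vec.map (keep x ∘ proj₁) (Vec.fromList ps) Vec.++ [] ∷ [])

  bobBlock : Bool → Vec (List G) blockLength
  bobBlock y = [] ∷ (Vec.map (keep y ∘ proj₂) (Vec.fromList ps) Vec.++ (keep (not y) w₂ ++ u) ∷ [])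

  block : Bool → Bool → List G
  block x y = if x ∧ y then v ++ u else u ++ u

  interleave-blocks : ∀ x y → interleave (aliceBlock x) (bobBlock y) ≡ block x y
  interleave-blocks x y = begin
    interleave (aliceBlock x) (bobBlock y)
      ≡⟨ cong (keep (not x) w₁ ++_) (trans (interleave-++ (pairs proj₁ x) (pairs proj₂ y) ([] ∷ []) ((keep (not y) w₂ ++ u) ∷ []))
                                           (cong₂ _++_ (interleave-pairs x y ps) (++-identityʳ (keep (not y) w₂ ++ u)))) ⟩
    keep (not x) w₁ ++ (concatMap (λ p → keep x (proj₁ p) ++ keep y (proj₂ p)) ps ++ (keep (not y) w₂ ++ u))
      ≡⟨ merge x y ⟩
    block x y ∎
    where
    open ≡-Reasoning
    pairs : (List G × List G → List G) → Bool → Vec (List G) (length ps)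
    pairs π b = Vec.map (keep b ∘ π) (Vec.fromList ps)
    merge : ∀ x y → keep (not x) w₁ ++ (concatMap (λ p → keep x (proj₁ p) ++ keep y (proj₂ p)) ps ++ (keep (not y) w₂ ++ u))
                    ≡ block x y
    merge true  true  = refl
    merge true  false = trans (cong (_++ (w₂ ++ u)) (concatMap-cong (λ p → ++-identityʳ (proj₁ p)) ps)) (sym (++-assoc w₁ w₂ u))
    merge false true  = sym (++-assoc w₁ w₂ u)
    merge false false = trans (cong (λ w → w₁ ++ (w ++ (w₂ ++ u))) (concatMap-[] ps)) (sym (++-assoc w₁ w₂ u))

  blocks : ∀ {m} → Vec Bool m → Vec Bool m → List G
  blocks []      []      = []
  blocks (x ∷ a) (y ∷ b) = block x y ++ blocks a b

  -- Round 0 carries u, then come the blocks of the m bits and r empty rounds of padding.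
  aliceInput : ∀ {m} r → Vec Bool m → Vec Carrier (suc (m * blockLength + r))
  aliceInput r a = Vec.map E (u ∷ (Vec.concat (Vec.map aliceBlock a) Vec.++ Vec.replicate r []))

  bobInput : ∀ {m} r → Vec Bool m → Vec Carrier (suc (m * blockLength + r))
  bobInput r b = Vec.map E ([] ∷ (Vec.concat (Vec.map bobBlock b) Vec.++ Vec.replicate r []))

  interleave-concat-blocks : ∀ {m} (a b : Vec Bool m) →
    interleave (Vec.concat (Vec.map aliceBlock a)) (Vec.concat (Vec.map bobBlock b)) ≡ blocks a b
  interleave-concat-blocks []      []      = refl
  interleave-concat-blocks (x ∷ a) (y ∷ b) =
    trans (interleave-++ (aliceBlock x) (bobBlock y) _ _) (cong₂ _++_ (interleave-blocks x y) (interleave-concat-blocks a b))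

  interleavedProduct-inputs : ∀ {m} r (a b : Vec Bool m) →
                              interleavedProduct M (aliceInput r a) (bobInput r b) ≈ E (u ++ blocks a b)
  interleavedProduct-inputs r a b =
    ≈-trans (interleavedProduct-eval M ι (u ∷ (A Vec.++ Vec.replicate r [])) ([] ∷ (B Vec.++ Vec.replicate r [])))
            (≈-reflexive (cong (λ w → E (u ++ w)) padded))
    where
    A = Vec.concat (Vec.map aliceBlock a)
    B = Vec.concat (Vec.map bobBlock b)
    padded : interleave (A Vec.++ Vec.replicate r []) (B Vec.++ Vec.replicate r []) ≡ blocks a b
    padded = trans (interleave-++ A B _ _)
                   (trans (cong₂ _++_ (interleave-concat-blocks a b) (interleave-replicate r)) (++-identityʳ _))

  module _ (idempotent : IsIdempotent M (E u)) where

    absorb : ∀ w → E (u ++ u ++ w) ≈ E (u ++ w)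
    absorb w = begin
      E (u ++ u ++ w)      ≈⟨ eval-++ M ι u (u ++ w) ⟩
      E u ∙ E (u ++ w)     ≈⟨ ∙-congˡ (eval-++ M ι u w) ⟩
      E u ∙ (E u ∙ E w)    ≈⟨ ≈-sym (assoc (E u) (E u) (E w)) ⟩
      (E u ∙ E u) ∙ E w    ≈⟨ ∙-congʳ idempotent ⟩
      E u ∙ E w            ≈⟨ ≈-sym (eval-++ M ι u w) ⟩
      E (u ++ w)           ∎
      where open import Relation.Binary.Reasoning.Setoid (OrderedMonoid.setoid M)

    absorb-block : ∀ x y w → x ∧ y ≡ false → E (u ++ block x y ++ w) ≈ E (u ++ w)
    absorb-block x y w x∧y rewrite x∧y | ++-assoc u u w = ≈-trans (absorb (u ++ w)) (absorb w)

    product-disjoint : ∀ {m} {a b : Vec Bool m} → Disjoint a b → E (u ++ blocks a b) ≈ E u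
    product-disjoint []                        = ≈-reflexive (cong E (++-identityʳ u))
    product-disjoint {a = x ∷ _} {y ∷ _} (x∧y ∷ d) = ≈-trans (absorb-block x y _ x∧y) (product-disjoint d)

    product-uniquelyIntersecting : ∀ {m} {a b : Vec Bool m} → UniquelyIntersecting a b → E (u ++ blocks a b) ≈ E (u ++ v ++ u)
    product-uniquelyIntersecting {a = x ∷ _} {y ∷ _} (there x∧y ui) =
      ≈-trans (absorb-block x y _ x∧y) (product-uniquelyIntersecting ui)
    product-uniquelyIntersecting {a = _ ∷ a} {_ ∷ b} (here d) =
      ≈-trans (≈-reflexive (cong E (trans (cong (u ++_) (++-assoc v u (blocks a b))) (sym (++-assoc u v (u ++ blocks a b))))))
              (≈-trans (eval-++-cong M ι (u ++ v) (product-disjoint d))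
                       (≈-reflexive (cong E (++-assoc u v u))))

    module _ (uvu≰u : ¬ (E (u ++ v ++ u) ≤ᴹ E u)) where

      evaluation-lowerBound : ∀ {n m} r → n ≡ suc (m * blockLength + r) →
        (P : NDProtocol {X = Vec Carrier n} {Y = Vec Carrier n}) → Computes P (EvalProblem M (Below M (E u)) n) →
        ∀ k → CostAtMost P (EvalProblem M (Below M (E u)) n) k → m < 4 * suc k
      evaluation-lowerBound {m = m} r refl P computes k cost =
        disjointness-lowerBound m (λ s → precompose α β (P s)) k accepts rejects
        where
        α = aliceInput r
        β = bobInput r
        accepts : ∀ a b → Disjoint a b →
                  ∃ λ s → Accepts (λ s → precompose α β (P s)) s a b × length s + bits (precompose α β (P s)) a b ≤ k
        accepts a b d with cost (α a) (β b) (lift (≤ᴹ-reflexive (≈-trans (interleavedProduct-inputs r a b) (product-disjoint d))))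
        ... | s , acc , s+bits≤k =
          s , trans (output-precompose α β (P s) a b) acc , subst (λ t → length s + t ≤ k) (sym (bits-precompose α β (P s) a b)) s+bits≤k
        rejects : ∀ s a b → Accepts (λ s → precompose α β (P s)) s a b → ¬ UniquelyIntersecting a b
        rejects s a b acc ui = uvu≰u (≤-respˡ-≈ (≈-trans (interleavedProduct-inputs r a b) (product-uniquelyIntersecting ui))
          (lower (Equivalence.from (computes (α a) (β b)) (s , trans (sym (output-precompose α β (P s) a b)) acc))))

linear-lowerBound : ∀ L .{{_ : NonZero L}} n k → 4 * L < n →
                    (∀ m r → n ≡ suc (m * L + r) → m < 4 * suc k) → n ≤ 8 * L * k
linear-lowerBound L (suc n) k 4L<1+n bound = go k (bound q r (cong suc n≡qL+r))
  where
  open ≤-Reasoning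
  q = n / L
  r = n % L
  n≡qL+r : n ≡ q * L + r
  n≡qL+r = trans (m≡m%n+[m/n]*n n L) (+-comm r (q * L))
  n<[1+q]L : n < suc q * L
  n<[1+q]L = begin-strict
    n         ≡⟨ n≡qL+r ⟩
    q * L + r <⟨ +-monoʳ-< (q * L) (m%n<n n L) ⟩
    q * L + L ≡⟨ +-comm (q * L) L ⟩
    suc q * L ∎
  4≤q : 4 ≤ q
  4≤q = s≤s⁻¹ (*-cancelʳ-< L 4 (suc q) (≤-<-trans (s≤s⁻¹ 4L<1+n) n<[1+q]L))
  4[2+k]≤8[1+k] : ∀ k → 4 * suc (suc k) ≤ 8 * suc k
  4[2+k]≤8[1+k] k = begin
    4 * suc (suc k) ≡⟨ solve 1 (λ k → con 4 :* (con 2 :+ k) := con 8 :+ con 4 :* k) refl k ⟩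
    8 + 4 * k       ≤⟨ +-monoʳ-≤ 8 (*-monoˡ-≤ k (m≤m+n 4 4)) ⟩
    8 + 8 * k       ≡⟨ solve 1 (λ k → con 8 :+ con 8 :* k := con 8 :* (con 1 :+ k)) refl k ⟩
    8 * suc k       ∎
  go : ∀ k → q < 4 * suc k → suc n ≤ 8 * L * k
  go zero    q<4      = contradiction 4≤q (<⇒≱ q<4)
  go (suc k) q<4[2+k] = begin
    suc n               ≤⟨ n<[1+q]L ⟩
    suc q * L           ≤⟨ *-monoˡ-≤ L q<4[2+k] ⟩
    4 * suc (suc k) * L ≤⟨ *-monoˡ-≤ L (4[2+k]≤8[1+k] k) ⟩
    8 * suc k * L       ≡⟨ *-assoc 8 (suc k) L ⟩
    8 * (suc k * L)     ≡⟨ cong (8 *_) (*-comm (suc k) L) ⟩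
    8 * (L * suc k)     ≡⟨ *-assoc 8 L (suc k) ⟨
    8 * L * suc k       ∎

lemma4p12 : ∀ {c ℓ₁ ℓ₂ g : Level} (M : OrderedMonoid c ℓ₁ ℓ₂) →
    IsFinite M →
    {G : Set g} (ι : G → OrderedMonoid.Carrier M) → Generates M ι →
    (u v w₁ w₂ : List G) →
    u ≡ w₁ ++ w₂ →
    IsShuffle v w₁ w₂ →
    IsIdempotent M (eval M ι u) →
    ¬ (OrderedMonoid._≤_ M (eval M ι (u ++ v ++ u)) (eval M ι u)) →
    N¹-Ω-linear M
lemma4p12 M _ ι _ _ _ _ _ refl (ps , refl , refl , refl) idempotent uvu≰u =
  8 * blockLength , suc (4 * blockLength) , λ n 4L<n →
    Below M (eval M ι u) , Below-isOrderIdeal M (eval M ι u) , λ P computes k cost →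
      linear-lowerBound blockLength n k 4L<n
        (λ m r n≡ → evaluation-lowerBound idempotent uvu≰u r n≡ P computes k cost)
  where open ShuffleEncoding M ι ps
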